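{- Let $\Omega$ be a finite set, $\mathcal{C}\le\mathbb{F}_q^\Omega$ a linear code, and $G\le\mathrm{PAut}(\mathcal{C})$ a subgroup whose order is coprime to $q$. Then $G^{(2)}\le\mathrm{PAut}(\mathcal{C})$.
   Context: For $g\in\mathrm{Sym}(\Omega)$ and $f\in\mathbb{F}_q^\Omega$, $f^g(\omega)=f(\omega^{g^{ -1}})$; $\mathrm{PAut}(\mathcal{C})=\{g\in\mathrm{Sym}(\Omega):\mathcal{C}^g=\mathcal{C}\}$. A subgroup $G\le\mathrm{Sym}(\Omega)$ acts on $\Omega\times\Omega$ by $(\alpha,\beta)^g=(\alpha^g,\beta^g)$; the orbits are its 2-orbits. Two subgroups are 2-equivalent if they have the same 2-orbits, and the 2-closure $G^{(2)}$ is the subgroup of $\mathrm{Sym}(\Omega)$ generated by all subgroups 2-equivalent to $G$ (equivalently, the set of all permutations preserving every 2-orbit of $G$). -}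

module Defs where

open import Level using (Level; _⊔_) renaming (suc to lsuc)
open import Data.Nat using (ℕ)
open import Data.Fin using (Fin)
open import Data.List using (List; length)
open import Data.List.Relation.Unary.Any using (Any)
open import Data.List.Relation.Unary.AllPairs using (AllPairs)
open import Data.Product using (Σ; ∃; _×_)
open import Relation.Nullary using (¬_)
open import Relation.Binary.PropositionalEquality using (_≡_)
open import Algebra.Bundles using (CommutativeRing)
open import Data.Fin.Permutation as P using (Permutation′; _⟨$⟩ʳ_; _⟨$⟩ˡ_; _∘ₚ_)

record FiniteField (c ℓ : Level) (q : ℕ) : Set (lsuc (c ⊔ ℓ)) where
  field
    commRing : CommutativeRing c ℓ
  open CommutativeRing commRing public
  field
    0≉1       : ¬ (0# ≈ 1#)
    inverse   : ∀ x → ¬ (x ≈ 0#) → ∃ λ y → (x * y) ≈ 1#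
    enum      : Fin q → Carrier
    enum-inj  : ∀ i j → enum i ≈ enum j → i ≡ j
    enum-surj : ∀ x → ∃ λ i → enum i ≈ x

module _ {c ℓ : Level} {q : ℕ} (F : FiniteField c ℓ q) where
  open FiniteField F

  Word : ℕ → Set c
  Word n = Fin n → Carrier

  _≈w_ : ∀ {n} → Word n → Word n → Set ℓ
  f ≈w g = ∀ ω → f ω ≈ g ω

  record LinearCode (n : ℕ) (p : Level) : Set (c ⊔ ℓ ⊔ lsuc p) where
    field
      _∈C        : Word n → Set p
      resp       : ∀ f g → f ≈w g → f ∈C → g ∈C
      zero∈      : (λ _ → 0#) ∈C
      +-closed   : ∀ f g → f ∈C → g ∈C → (λ ω → f ω + g ω) ∈C
      *-closed   : ∀ a f → f ∈C → (λ ω → a * f ω) ∈C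

  -- The action f^g(ω) = f(ω^{g⁻¹}).
  act : ∀ {n} → Word n → Permutation′ n → Word n
  act f g ω = f (g ⟨$⟩ˡ ω)

  -- g ∈ PAut(C) iff C^g = C, i.e. C^g ⊆ C and C ⊆ C^g.
  InPAut : ∀ {n p} → LinearCode n p → Permutation′ n → Set (c ⊔ ℓ ⊔ p)
  InPAut C g =
      (∀ f → f ∈C → act f g ∈C)
    × (∀ f → f ∈C → Σ (Word _) λ f′ → f′ ∈C × (act f′ g ≈w f))
    where open LinearCode C

record PermGroup (n : ℕ) : Set where
  field
    elems    : List (Permutation′ n)
  _∈G : Permutation′ n → Set
  g ∈G = Any (λ h → h P.≈ g) elems
  field
    distinct : AllPairs (λ g h → ¬ (g P.≈ h)) elems
    id∈      : P.id ∈G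
    ∘-closed : ∀ g h → g ∈G → h ∈G → (g ∘ₚ h) ∈G
    inv∈     : ∀ g → g ∈G → P.flip g ∈G

  order : ℕ
  order = length elems

  -- g lies in the 2-closure G^(2): g preserves every 2-orbit of G, i.e.
  -- for all α, β some h ∈ G maps (α, β) to (α^g, β^g).
  InTwoClosure : Permutation′ n → Set
  InTwoClosure g = ∀ α β → Σ (Permutation′ n) λ h →
    h ∈G × (h ⟨$⟩ʳ α ≡ g ⟨$⟩ʳ α) × (h ⟨$⟩ʳ β ≡ g ⟨$⟩ʳ β)

module Submission where

-- Fix a codeword f. All f^h (h ∈ G) lie in C, so some matrix K with columns in C
-- fixes all of them (add rank-one corrections one vector at a time). Averaging the
-- conjugates of K over G gives a matrix P with columns in C that fixes f and is
-- constant on the 2-orbits of G; dividing by |G| is possible because q·1 = 0 in F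
-- and gcd(|G|, q) = 1. A permutation g of G⁽²⁾ preserves the 2-orbits, so it
-- commutes with P, and f^g = (P f)^g = P (f^g) ∈ C.

open import Defs
open import Level using (Level)
open import Function using (_∘_)
open import Data.Nat as ℕ using (ℕ; zero; suc)
open import Data.Nat.Coprimality using (Coprime; coprime-Bézout)
open import Data.Nat.GCD using (module Bézout)
open import Data.Fin using (Fin; zero; suc)
import Data.Fin as Fin
open import Data.Fin.Properties using (all?; ¬∀⟶∃¬)
open import Data.Fin.Permutation as P using (Permutation′; _⟨$⟩ʳ_; _⟨$⟩ˡ_; _∘ₚ_)
open import Data.List using (_∷_; lookup)
open import Data.List.Membership.Propositional.Properties using (∈-lookup)
open import Data.List.Relation.Unary.Any as Any using (Any; here; there)
open import Data.List.Relation.Unary.Any.Properties using (lookup-index)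
import Data.List.Relation.Unary.All as All
open import Data.List.Relation.Unary.AllPairs using (AllPairs; _∷_)
open import Data.Product using (Σ; ∃; _×_; _,_; proj₁; proj₂)
open import Data.Vec.Functional using (Vector)
open import Data.Empty using (⊥-elim)
open import Relation.Binary using (Rel; Reflexive; Symmetric; Decidable)
open import Relation.Nullary using (¬_; yes; no)
open import Relation.Binary.PropositionalEquality as ≡ using (_≡_)
open import Algebra.Bundles using (CommutativeRing; CommutativeMonoid)

module _ {a r} {A : Set a} {_∼_ : Rel A r} where

  lookup-any : Reflexive _∼_ → ∀ xs i → Any (_∼ lookup xs i) xs
  lookup-any ∼-refl (x ∷ xs) zero    = here ∼-refl
  lookup-any ∼-refl (x ∷ xs) (suc i) = there (lookup-any ∼-refl xs i)

  lookup-injective : Symmetric _∼_ → ∀ {xs} → AllPairs (λ x y → ¬ x ∼ y) xs →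
                     ∀ i j → lookup xs i ∼ lookup xs j → i ≡ j
  lookup-injective ∼-sym (_ ∷ _)    zero    zero    _ = ≡.refl
  lookup-injective ∼-sym (x≁ ∷ _)   zero    (suc j) e = ⊥-elim (All.lookup x≁ (∈-lookup j) e)
  lookup-injective ∼-sym (x≁ ∷ _)   (suc i) zero    e = ⊥-elim (All.lookup x≁ (∈-lookup i) (∼-sym e))
  lookup-injective ∼-sym (_ ∷ xs≁)  (suc i) (suc j) e = ≡.cong suc (lookup-injective ∼-sym xs≁ i j e)

module _ {n : ℕ} (G : PermGroup n) where
  open PermGroup G

  element : Fin order → Permutation′ n
  element = lookup elems

  element-∈G : ∀ i → element i ∈G
  element-∈G = lookup-any {_∼_ = P._≈_ {n} {n}} (λ _ → ≡.refl) elems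

  private
    translate : ∀ k → k ∈G → Fin order → Fin order
    translate k k∈G i = Any.index (∘-closed k (element i) k∈G (element-∈G i))

    translate-correct : ∀ k (k∈G : k ∈G) i → element (translate k k∈G i) P.≈ k ∘ₚ element i
    translate-correct k k∈G i = lookup-index (∘-closed k (element i) k∈G (element-∈G i))

    translate-inverse : ∀ k l (k∈G : k ∈G) (l∈G : l ∈G) → (∀ x → l ⟨$⟩ʳ (k ⟨$⟩ʳ x) ≡ x) →
                        ∀ i → translate k k∈G (translate l l∈G i) ≡ i
    translate-inverse k l k∈G l∈G lk≡id i =
      lookup-injective {_∼_ = P._≈_ {n} {n}} (λ e x → ≡.sym (e x)) distinct _ _ same-action
      where
      open ≡.≡-Reasoning
      same-action : element (translate k k∈G (translate l l∈G i)) P.≈ element i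
      same-action x = begin
        element (translate k k∈G (translate l l∈G i)) ⟨$⟩ʳ x  ≡⟨ translate-correct k k∈G _ x ⟩
        element (translate l l∈G i) ⟨$⟩ʳ (k ⟨$⟩ʳ x)           ≡⟨ translate-correct l l∈G i _ ⟩
        element i ⟨$⟩ʳ (l ⟨$⟩ʳ (k ⟨$⟩ʳ x))                    ≡⟨ ≡.cong (element i ⟨$⟩ʳ_) (lk≡id x) ⟩
        element i ⟨$⟩ʳ x                                      ∎

  leftTranslation : ∀ k → k ∈G → Permutation′ order
  leftTranslation k k∈G = P.permutation (translate k k∈G) (translate k⁻¹ k⁻¹∈G)
    (translate-inverse k k⁻¹ k∈G k⁻¹∈G (λ _ → P.inverseˡ k))
    (translate-inverse k⁻¹ k k⁻¹∈G k∈G (λ _ → P.inverseʳ k))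
    where
    k⁻¹ = P.flip k
    k⁻¹∈G = inv∈ k k∈G

  two-closure-flip : ∀ {g} → InTwoClosure g → InTwoClosure (P.flip g)
  two-closure-flip {g} g∈G⁽²⁾ α β with g∈G⁽²⁾ (g ⟨$⟩ˡ α) (g ⟨$⟩ˡ β)
  ... | h , h∈G , hα′≡α , hβ′≡β = P.flip h , inv∈ h h∈G , undo α hα′≡α , undo β hβ′≡β
    where
    undo : ∀ x → h ⟨$⟩ʳ (g ⟨$⟩ˡ x) ≡ g ⟨$⟩ʳ (g ⟨$⟩ˡ x) → h ⟨$⟩ˡ x ≡ g ⟨$⟩ˡ x
    undo x e = ≡.trans (≡.cong (h ⟨$⟩ˡ_) (≡.sym (≡.trans e (P.inverseʳ g)))) (P.inverseˡ h)

  module _ {c ℓ} (M : CommutativeMonoid c ℓ) where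
    open CommutativeMonoid M renaming (_∙_ to _+_)
    open import Algebra.Properties.CommutativeMonoid.Sum M
    open import Relation.Binary.Reasoning.Setoid setoid

    ∑-translate : ∀ (Φ : Permutation′ n → Carrier) → (∀ {g h} → g P.≈ h → Φ g ≈ Φ h) →
                  ∀ k → k ∈G → ∑[ i < order ] Φ (k ∘ₚ element i) ≈ ∑[ i < order ] Φ (element i)
    ∑-translate Φ Φ-cong k k∈G = sym (begin
      ∑[ i < order ] Φ (element i)
        ≈⟨ ∑-permute _ (leftTranslation k k∈G) ⟩
      ∑[ i < order ] Φ (element (leftTranslation k k∈G ⟨$⟩ʳ i))
        ≈⟨ sum-cong-≋ (Φ-cong ∘ translate-correct k k∈G) ⟩
      ∑[ i < order ] Φ (k ∘ₚ element i)
        ∎)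

module _ {c ℓ} (R : CommutativeRing c ℓ) where
  open CommutativeRing R
  open import Algebra.Properties.Semiring.Mult semiring using (×1-homo-*) renaming (_×_ to _×ᵣ_)
  open import Relation.Binary.Reasoning.Setoid setoid

  ×1#≈0#-multiple : ∀ {a} k → a ×ᵣ 1# ≈ 0# → (k ℕ.* a) ×ᵣ 1# ≈ 0#
  ×1#≈0#-multiple {a} k a≈0 = begin
    (k ℕ.* a) ×ᵣ 1#          ≈⟨ ×1-homo-* k a ⟩
    (k ×ᵣ 1#) * (a ×ᵣ 1#)    ≈⟨ *-congˡ a≈0 ⟩
    (k ×ᵣ 1#) * 0#           ≈⟨ zeroʳ _ ⟩
    0#                       ∎

  1+ka≡lb⇒1#≈0# : ∀ {a b} k l → a ×ᵣ 1# ≈ 0# → b ×ᵣ 1# ≈ 0# → 1 ℕ.+ k ℕ.* a ≡ l ℕ.* b → 1# ≈ 0#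
  1+ka≡lb⇒1#≈0# {a} {b} k l a≈0 b≈0 eq = begin
    1#                      ≈⟨ +-identityʳ 1# ⟨
    1# + 0#                 ≈⟨ +-congˡ (×1#≈0#-multiple k a≈0) ⟨
    (1 ℕ.+ k ℕ.* a) ×ᵣ 1#   ≡⟨ ≡.cong (_×ᵣ 1#) eq ⟩
    (l ℕ.* b) ×ᵣ 1#         ≈⟨ ×1#≈0#-multiple l b≈0 ⟩
    0#                      ∎

  coprime⇒×1#≉0# : ¬ (0# ≈ 1#) → ∀ {m q} → q ×ᵣ 1# ≈ 0# → Coprime m q → ¬ (m ×ᵣ 1# ≈ 0#)
  coprime⇒×1#≉0# 0≉1 q≈0 m⊥q m≈0 with coprime-Bézout m⊥q
  ... | Bézout.+- x y eq = 0≉1 (sym (1+ka≡lb⇒1#≈0# y x q≈0 m≈0 eq))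
  ... | Bézout.-+ x y eq = 0≉1 (sym (1+ka≡lb⇒1#≈0# x y m≈0 q≈0 eq))

module Matrices {c ℓ} (R : CommutativeRing c ℓ) where
  open CommutativeRing R hiding (zero)
  open import Algebra.Properties.Ring ring using (-1*x≈-x)
  open import Algebra.Properties.Semiring.Sum semiring
  open import Algebra.Properties.Semiring.Mult semiring
    using (×-congʳ; ×-assoc-*) renaming (_×_ to _×ᵣ_)
  open import Data.Vec.Functional.Relation.Binary.Equality.Setoid setoid using (_≋_)
  open import Relation.Binary.Reasoning.Setoid setoid

  private variable n : ℕ

  Matrix : ℕ → Set c
  Matrix n = Fin n → Fin n → Carrier

  infixl 7 _·_ _⊙_

  _·_ : Vector Carrier n → Vector Carrier n → Carrier
  _·_ {n} u x = ∑[ β < n ] (u β * x β)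

  _⊙_ : Matrix n → Vector Carrier n → Vector Carrier n
  (M ⊙ x) α = M α · x

  ·-distribʳ-+ : ∀ (u v x : Vector Carrier n) → (λ β → u β + v β) · x ≈ u · x + v · x
  ·-distribʳ-+ {n} u v x =
    trans (sum-cong-≋ {n} (λ β → distribʳ (x β) (u β) (v β))) (∑-distrib-+ {n} _ _)

  *-assoc-· : ∀ a (u x : Vector Carrier n) → (λ β → a * u β) · x ≈ a * (u · x)
  *-assoc-· {n} a u x =
    trans (sum-cong-≋ {n} (λ β → *-assoc a (u β) (x β))) (sym (*-distribˡ-sum {n} a _))

  -‿distribˡ-· : ∀ (u x : Vector Carrier n) → (λ β → - u β) · x ≈ - (u · x)
  -‿distribˡ-· {n} u x = begin
    (λ β → - u β) · x        ≈⟨ sum-cong-≋ {n} (λ β → *-congʳ (sym (-1*x≈-x (u β)))) ⟩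
    (λ β → - 1# * u β) · x   ≈⟨ *-assoc-· (- 1#) u x ⟩
    - 1# * (u · x)           ≈⟨ -1*x≈-x _ ⟩
    - (u · x)                ∎

  δ : Matrix n
  δ zero    zero    = 1#
  δ zero    (suc _) = 0#
  δ (suc _) zero    = 0#
  δ (suc α) (suc β) = δ α β

  δ-· : ∀ ω (x : Vector Carrier n) → δ ω · x ≈ x ω
  δ-· {suc n} zero x = begin
    1# * x zero + ∑[ β < n ] (0# * x (suc β))
      ≈⟨ +-cong (*-identityˡ _) (sum-cong-≋ (λ β → zeroˡ (x (suc β)))) ⟩
    x zero + ∑[ β < n ] 0#   ≈⟨ +-congˡ (sum-replicate-zero n) ⟩
    x zero + 0#              ≈⟨ +-identityʳ _ ⟩
    x zero                   ∎
  δ-· (suc ω) x = begin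
    0# * x zero + δ ω · (x ∘ suc) ≈⟨ +-cong (zeroˡ _) (δ-· ω (x ∘ suc)) ⟩
    0# + x (suc ω)                ≈⟨ +-identityˡ _ ⟩
    x (suc ω)                     ∎

  -- K + w ⊗ φ, where the functional φ x = d * (x - K ⊙ x) ω vanishes on every vector fixed by K.
  rankOneUpdate : Matrix n → Vector Carrier n → Carrier → Fin n → Matrix n
  rankOneUpdate K w d ω α β = K α β + w α * (d * (δ ω β - K ω β))

  rankOneUpdate-⊙ : ∀ (K : Matrix n) w d ω x α →
                    (rankOneUpdate K w d ω ⊙ x) α ≈ (K ⊙ x) α + w α * (d * (x ω - (K ⊙ x) ω))
  rankOneUpdate-⊙ K w d ω x α = begin
    (λ β → K α β + w α * φ β) · x    ≈⟨ ·-distribʳ-+ (K α) _ x ⟩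
    K α · x + (λ β → w α * φ β) · x  ≈⟨ +-congˡ (*-assoc-· (w α) φ x) ⟩
    K α · x + w α * (φ · x)          ≈⟨ +-congˡ (*-congˡ φ·x) ⟩
    K α · x + w α * (d * (x ω - K ω · x)) ∎
    where
    φ = λ β → d * (δ ω β - K ω β)
    φ·x : φ · x ≈ d * (x ω - K ω · x)
    φ·x = begin
      φ · x                                   ≈⟨ *-assoc-· d _ x ⟩
      d * ((λ β → δ ω β - K ω β) · x)         ≈⟨ *-congˡ (·-distribʳ-+ (δ ω) _ x) ⟩
      d * (δ ω · x + (λ β → - K ω β) · x)     ≈⟨ *-congˡ (+-cong (δ-· ω x) (-‿distribˡ-· (K ω) x)) ⟩
      d * (x ω - K ω · x)                     ∎

  Invariant : Permutation′ n → Matrix n → Set ℓ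
  Invariant g M = ∀ α β → M (g ⟨$⟩ʳ α) (g ⟨$⟩ʳ β) ≈ M α β

  ⊙-permute : ∀ {g} {M : Matrix n} → Invariant g M → ∀ x → M ⊙ (x ∘ (g ⟨$⟩ˡ_)) ≋ (M ⊙ x) ∘ (g ⟨$⟩ˡ_)
  ⊙-permute {n} {g} {M} g-inv x α = begin
    ∑[ β < n ] (M α β * x (g ⟨$⟩ˡ β))
      ≈⟨ ∑-permute _ g ⟩
    ∑[ γ < n ] (M α (g ⟨$⟩ʳ γ) * x (g ⟨$⟩ˡ (g ⟨$⟩ʳ γ)))
      ≈⟨ sum-cong-≋ {n} (λ γ → *-cong (entry γ) (reflexive (≡.cong x (P.inverseˡ g)))) ⟩
    ∑[ γ < n ] (M (g ⟨$⟩ˡ α) γ * x γ)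
      ∎
    where
    entry : ∀ γ → M α (g ⟨$⟩ʳ γ) ≈ M (g ⟨$⟩ˡ α) γ
    entry γ = trans (reflexive (≡.cong (λ α′ → M α′ (g ⟨$⟩ʳ γ)) (≡.sym (P.inverseʳ g)))) (g-inv _ γ)

  module _ (G : PermGroup n) where
    open PermGroup G

    invariant-two-closure : ∀ {g} {M : Matrix n} → InTwoClosure g → (∀ h → h ∈G → Invariant h M) →
                            Invariant g M
    invariant-two-closure {g} {M} g∈G⁽²⁾ G-inv α β with g∈G⁽²⁾ α β
    ... | h , h∈G , hα≡gα , hβ≡gβ = begin
      M (g ⟨$⟩ʳ α) (g ⟨$⟩ʳ β)  ≡⟨ ≡.cong₂ M hα≡gα hβ≡gβ ⟨
      M (h ⟨$⟩ʳ α) (h ⟨$⟩ʳ β)  ≈⟨ G-inv h h∈G α β ⟩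
      M α β                    ∎

    average : Carrier → Matrix n → Matrix n
    average a K α β = a * ∑[ i < order ] K (element G i ⟨$⟩ʳ α) (element G i ⟨$⟩ʳ β)

    average-invariant : ∀ a K k → k ∈G → Invariant k (average a K)
    average-invariant a K k k∈G α β = *-congˡ (∑-translate G +-commutativeMonoid
      (λ h → K (h ⟨$⟩ʳ α) (h ⟨$⟩ʳ β)) (λ g≈h → reflexive (≡.cong₂ K (g≈h α) (g≈h β))) k k∈G)

    average-⊙ : ∀ {a K} x → a * (order ×ᵣ 1#) ≈ 1# →
                (∀ i → K ⊙ (x ∘ (element G i ⟨$⟩ˡ_)) ≋ x ∘ (element G i ⟨$⟩ˡ_)) →
                average a K ⊙ x ≋ x
    average-⊙ {a} {K} x a|G|≈1 K-fixes α = begin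
      (λ β → a * S β) · x
        ≈⟨ *-assoc-· a S x ⟩
      a * (S · x)
        ≈⟨ *-congˡ (sum-cong-≋ {n} λ β → *-distribʳ-sum {order} (x β) _) ⟩
      a * ∑[ β < n ] ∑[ i < order ] (K (h i ⟨$⟩ʳ α) (h i ⟨$⟩ʳ β) * x β)
        ≈⟨ *-congˡ (∑-comm {n} {order} _) ⟩
      a * ∑[ i < order ] ∑[ β < n ] (K (h i ⟨$⟩ʳ α) (h i ⟨$⟩ʳ β) * x β)
        ≈⟨ *-congˡ (sum-cong-≋ {order} summand) ⟩
      a * ∑[ i < order ] x α       ≈⟨ *-congˡ (sum-replicate order) ⟩
      a * (order ×ᵣ x α)           ≈⟨ *-congˡ (×-congʳ order (*-identityˡ (x α))) ⟨
      a * (order ×ᵣ (1# * x α))    ≈⟨ *-congˡ (×-assoc-* order 1# (x α)) ⟨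
      a * ((order ×ᵣ 1#) * x α)    ≈⟨ *-assoc _ _ _ ⟨
      a * (order ×ᵣ 1#) * x α      ≈⟨ *-congʳ a|G|≈1 ⟩
      1# * x α                     ≈⟨ *-identityˡ _ ⟩
      x α                          ∎
      where
      h = element G
      S = λ β → ∑[ i < order ] K (h i ⟨$⟩ʳ α) (h i ⟨$⟩ʳ β)
      summand : ∀ i → ∑[ β < n ] (K (h i ⟨$⟩ʳ α) (h i ⟨$⟩ʳ β) * x β) ≈ x α
      summand i = begin
        ∑[ β < n ] (K (h i ⟨$⟩ʳ α) (h i ⟨$⟩ʳ β) * x β)
          ≈⟨ ∑-permute _ (P.flip (h i)) ⟩
        ∑[ γ < n ] (K (h i ⟨$⟩ʳ α) (h i ⟨$⟩ʳ (h i ⟨$⟩ˡ γ)) * x (h i ⟨$⟩ˡ γ))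
          ≈⟨ sum-cong-≋ {n} (λ γ → *-congʳ (reflexive (≡.cong (K _) (P.inverseʳ (h i))))) ⟩
        (K ⊙ (x ∘ (h i ⟨$⟩ˡ_))) (h i ⟨$⟩ʳ α)
          ≈⟨ K-fixes i (h i ⟨$⟩ʳ α) ⟩
        x (h i ⟨$⟩ˡ (h i ⟨$⟩ʳ α))
          ≡⟨ ≡.cong x (P.inverseˡ (h i)) ⟩
        x α
          ∎

module _ {c ℓ q} (F : FiniteField c ℓ q) where
  open FiniteField F hiding (zero)
  open Matrices commRing
  open import Algebra.Properties.Ring ring
    using (//-rightDividesˡ; //-rightDividesʳ; +-identityʳ-unique; -1*x≈-x; x∙y⁻¹≈ε⇒x≈y; x≈y⇒x∙y⁻¹≈ε)
  open import Algebra.Properties.Semiring.Sum semiring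
    using (sum-syntax; ∑-permute; ∑-distrib-+; sum-replicate; sum-cong-≋)
  open import Algebra.Properties.Semiring.Mult semiring using () renaming (_×_ to _×ᵣ_)
  open import Data.Vec.Functional.Relation.Binary.Equality.Setoid setoid using (_≋_)
  open import Relation.Binary.Reasoning.Setoid setoid

  _≟_ : Decidable _≈_
  x ≟ y with enum-surj x | enum-surj y
  ... | i , i↦x | j , j↦y with i Fin.≟ j
  ... | yes ≡.refl = yes (trans (sym i↦x) j↦y)
  ... | no i≢j     = no (λ x≈y → i≢j (enum-inj i j (trans i↦x (trans x≈y (sym j↦y)))))

  private
    index : Carrier → Fin q
    index x = proj₁ (enum-surj x)

    enum-index : ∀ x → enum (index x) ≈ x
    enum-index x = proj₂ (enum-surj x)

  translation : Carrier → Permutation′ q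
  translation a = P.permutation (λ i → index (enum i + a)) (λ i → index (enum i - a))
    (λ i → enum-inj _ _ (begin
      enum (index (enum (index (enum i - a)) + a))  ≈⟨ enum-index _ ⟩
      enum (index (enum i - a)) + a                 ≈⟨ +-congʳ (enum-index _) ⟩
      enum i - a + a                                ≈⟨ //-rightDividesˡ a (enum i) ⟩
      enum i                                        ∎))
    (λ i → enum-inj _ _ (begin
      enum (index (enum (index (enum i + a)) - a))  ≈⟨ enum-index _ ⟩
      enum (index (enum i + a)) - a                 ≈⟨ +-congʳ (enum-index _) ⟩
      enum i + a - a                                ≈⟨ //-rightDividesʳ a (enum i) ⟩
      enum i                                        ∎))

  q×1#≈0# : q ×ᵣ 1# ≈ 0#
  q×1#≈0# = +-identityʳ-unique S (q ×ᵣ 1#) (sym (begin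
    S                                        ≈⟨ ∑-permute enum (translation 1#) ⟩
    ∑[ i < q ] enum (index (enum i + 1#))    ≈⟨ sum-cong-≋ {q} (λ i → enum-index _) ⟩
    ∑[ i < q ] (enum i + 1#)                 ≈⟨ ∑-distrib-+ {q} enum _ ⟩
    S + ∑[ i < q ] 1#                        ≈⟨ +-congˡ (sum-replicate q) ⟩
    S + q ×ᵣ 1#                              ∎))
    where S = ∑[ i < q ] enum i

  coprime⇒×1#-invertible : ∀ {m} → Coprime m q → ∃ λ a → a * (m ×ᵣ 1#) ≈ 1#
  coprime⇒×1#-invertible m⊥q with inverse _ (coprime⇒×1#≉0# commRing 0≉1 q×1#≈0# m⊥q)
  ... | a , m·a≈1 = a , trans (*-comm _ _) m·a≈1

  module _ {n p} (C : LinearCode F n p) where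
    open LinearCode C

    ColumnsIn : Matrix n → Set p
    ColumnsIn M = ∀ β → (λ α → M α β) ∈C

    ∑-closed : ∀ {k} (v : Fin k → Word F n) → (∀ i → v i ∈C) → (λ α → ∑[ i < k ] v i α) ∈C
    ∑-closed {zero}  v v∈C = zero∈
    ∑-closed {suc k} v v∈C = +-closed _ _ (v∈C zero) (∑-closed (v ∘ suc) (v∈C ∘ suc))

    difference-closed : ∀ f g → f ∈C → g ∈C → (λ α → f α - g α) ∈C
    difference-closed f g f∈C g∈C =
      +-closed f _ f∈C (resp _ _ (λ α → -1*x≈-x (g α)) (*-closed (- 1#) g g∈C))

    ⊙-closed : ∀ {M} → ColumnsIn M → ∀ x → (M ⊙ x) ∈C
    ⊙-closed {M} M-cols x = resp _ _ (λ α → sum-cong-≋ {n} (λ β → *-comm (x β) (M α β)))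
      (∑-closed (λ β α → x β * M α β) (λ β → *-closed (x β) _ (M-cols β)))

    rankOneUpdate-closed : ∀ {K w} d ω → ColumnsIn K → w ∈C → ColumnsIn (rankOneUpdate K w d ω)
    rankOneUpdate-closed {K} {w} d ω K-cols w∈C β = +-closed _ _ (K-cols β)
      (resp _ _ (λ α → *-comm _ (w α)) (*-closed (d * (δ ω β - K ω β)) w w∈C))

    extend-fixing-matrix : ∀ {K} v → ColumnsIn K → v ∈C →
      Σ (Matrix n) λ K′ → ColumnsIn K′ × K′ ⊙ v ≋ v × (∀ x → K ⊙ x ≋ x → K′ ⊙ x ≋ x)
    extend-fixing-matrix {K} v K-cols v∈C with all? (λ α → (K ⊙ v) α ≟ v α)
    ... | yes Kv≈v = K , K-cols , Kv≈v , λ _ Kx≈x → Kx≈x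
    ... | no Kv≉v with ¬∀⟶∃¬ n _ (λ α → (K ⊙ v) α ≟ v α) Kv≉v
    ...   | ω , Kvω≉vω with inverse (v ω - (K ⊙ v) ω) (λ rω≈0 → Kvω≉vω (sym (x∙y⁻¹≈ε⇒x≈y _ _ rω≈0)))
    ...     | d , rω·d≈1 =
        rankOneUpdate K r d ω
      , rankOneUpdate-closed d ω K-cols (difference-closed v _ v∈C (⊙-closed K-cols v))
      , fixes-v
      , fixes-fixed
      where
      r = λ α → v α - (K ⊙ v) α
      fixes-v : rankOneUpdate K r d ω ⊙ v ≋ v
      fixes-v α = begin
        (rankOneUpdate K r d ω ⊙ v) α  ≈⟨ rankOneUpdate-⊙ K r d ω v α ⟩
        (K ⊙ v) α + r α * (d * r ω)    ≈⟨ +-congˡ (*-congˡ (trans (*-comm d (r ω)) rω·d≈1)) ⟩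
        (K ⊙ v) α + r α * 1#           ≈⟨ +-congˡ (*-identityʳ _) ⟩
        (K ⊙ v) α + (v α - (K ⊙ v) α)  ≈⟨ +-comm _ _ ⟩
        v α - (K ⊙ v) α + (K ⊙ v) α    ≈⟨ //-rightDividesˡ _ _ ⟩
        v α                            ∎
      fixes-fixed : ∀ x → K ⊙ x ≋ x → rankOneUpdate K r d ω ⊙ x ≋ x
      fixes-fixed x Kx≈x α = begin
        (rankOneUpdate K r d ω ⊙ x) α
          ≈⟨ rankOneUpdate-⊙ K r d ω x α ⟩
        (K ⊙ x) α + r α * (d * (x ω - (K ⊙ x) ω))
          ≈⟨ +-cong (Kx≈x α) (*-congˡ (*-congˡ (x≈y⇒x∙y⁻¹≈ε (sym (Kx≈x ω))))) ⟩
        x α + r α * (d * 0#)   ≈⟨ +-congˡ (trans (*-congˡ (zeroʳ d)) (zeroʳ _)) ⟩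
        x α + 0#               ≈⟨ +-identityʳ _ ⟩
        x α                    ∎

    fixing-matrix : ∀ {k} (v : Fin k → Word F n) → (∀ i → v i ∈C) →
                    Σ (Matrix n) λ K → ColumnsIn K × (∀ i → K ⊙ v i ≋ v i)
    fixing-matrix {zero}  v v∈C = (λ _ _ → 0#) , (λ _ → zero∈) , λ ()
    fixing-matrix {suc k} v v∈C with fixing-matrix (v ∘ suc) (v∈C ∘ suc)
    ... | K , K-cols , K-fixes with extend-fixing-matrix (v zero) K-cols (v∈C zero)
    ...   | K′ , K′-cols , K′-fixes-v₀ , K′-keeps = K′ , K′-cols , λ where
      zero    → K′-fixes-v₀
      (suc i) → K′-keeps _ (K-fixes i)

    act-closed : ∀ {g M f} → Invariant g M → ColumnsIn M → M ⊙ f ≋ f → act F f g ∈C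
    act-closed {g} {M} {f} g-inv M-cols Mf≋f =
      resp _ _ (λ ω → trans (⊙-permute {g = g} {M} g-inv f ω) (Mf≋f (g ⟨$⟩ˡ ω)))
        (⊙-closed {M} M-cols (act F f g))

    module _ (G : PermGroup n) (G⊆PAut : ∀ g → PermGroup._∈G G g → InPAut F C g) where
      open PermGroup G

      average-closed : ∀ a {K} → ColumnsIn K → ColumnsIn (average G a K)
      average-closed a {K} K-cols β = *-closed a _ (∑-closed (λ i α → K (h i ⟨$⟩ʳ α) (h i ⟨$⟩ʳ β)) λ i →
        proj₁ (G⊆PAut (P.flip (h i)) (inv∈ (h i) (element-∈G G i))) _ (K-cols (h i ⟨$⟩ʳ β)))
        where h = element G

      invariant-fixing-matrix : ∀ {a} → a * (order ×ᵣ 1#) ≈ 1# → ∀ f → f ∈C →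
        Σ (Matrix n) λ M → ColumnsIn M × (∀ h → h ∈G → Invariant h M) × M ⊙ f ≋ f
      invariant-fixing-matrix {a} a|G|≈1 f f∈C
        with fixing-matrix (λ i → act F f (element G i))
                           (λ i → proj₁ (G⊆PAut (element G i) (element-∈G G i)) f f∈C)
      ... | K , K-cols , K-fixes =
          average G a K
        , average-closed a K-cols
        , average-invariant G a K
        , average-⊙ G f a|G|≈1 K-fixes

      two-closure-preserves : Coprime order q → ∀ g → InTwoClosure g → ∀ f → f ∈C → act F f g ∈C
      two-closure-preserves |G|⊥q g g∈G⁽²⁾ f f∈C
        with a , a|G|≈1 ← coprime⇒×1#-invertible |G|⊥q
        with M , M-cols , M-inv , Mf≋f ← invariant-fixing-matrix a|G|≈1 f f∈C
        = act-closed {g} {M} (invariant-two-closure G {g} {M} g∈G⁽²⁾ M-inv) M-cols Mf≋f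

theorem3p2 : ∀ {c ℓ p : Level} {q n : ℕ} (F : FiniteField c ℓ q)
    (C : LinearCode F n p) (G : PermGroup n) →
    (∀ g → PermGroup._∈G G g → InPAut F C g) →
    Coprime (PermGroup.order G) q →
    ∀ g → PermGroup.InTwoClosure G g → InPAut F C g
theorem3p2 F C G G⊆PAut |G|⊥q g g∈G⁽²⁾ =
    preserves g g∈G⁽²⁾
  , λ f f∈C → act F f (P.flip g)
            , preserves (P.flip g) (two-closure-flip G {g} g∈G⁽²⁾) f f∈C
            , λ _ → FiniteField.reflexive F (≡.cong f (P.inverseʳ g))
  where preserves = two-closure-preserves F C G G⊆PAut |G|⊥q
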